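{- Let $n\ge2$, $0\le k\le n$ and $0\le r<n$ be integers with $\gcd(n,k,r)=1$. Then there exist integers $y$ and $z$ such that the map $A\mapsto\{(za+y)\bmod n : a\in A\}$ is a bijection from $\bar S_r(n,k)$ to $\bar S_1(n,k)$.
   Context: Subsets of $[n]=\{1,\dots,n\}$ are identified with subsets of $\mathbb{Z}/n\mathbb{Z}$ (identifying $n$ with $0$), so $(za+y)\bmod n$ is taken as the representative in $\{1,\dots,n\}$ (equivalently in $\{0,\dots,n-1\}$). $\bar S_r(n,k)$ is the set of $k$-element subsets of $[n]$ the sum of whose elements is congruent to $r$ modulo $n$. -}

module Defs where

open import Data.Nat using (ℕ; _%_; NonZero)
open import Data.Integer using (ℤ; +_) renaming (_*_ to _*ℤ_; _+_ to _+ℤ_)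
open import Data.Integer.DivMod using (_%ℕ_; n%ℕd<d)
open import Data.Fin using (Fin; toℕ; fromℕ<)
open import Data.Fin.Subset using (Subset; ∣_∣)
open import Data.Fin.Subset.Properties using (_∈?_)
open import Data.Fin.Properties using (any?; _≟_)
open import Data.Bool using (if_then_else_)
open import Data.Vec using (tabulate; lookup)
open import Data.List using (map; allFin)
open import Data.Nat.ListAction using (sum)
open import Relation.Nullary using (does)
open import Relation.Nullary.Decidable using (_×-dec_)
open import Relation.Binary.PropositionalEquality using (_≡_)

-- Elements of [n] are identified with Z/nZ, represented by Fin n = {0,…,n-1}
-- (the element n of [n] is the residue 0).

subsetSum : ∀ {n} → Subset n → ℕ
subsetSum {n} A = sum (map (λ j → if lookup A j then toℕ j else 0) (allFin n))

S̄ : (r n k : ℕ) .{{_ : NonZero n}} → Subset n → Set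
S̄ r n k A = (∣ A ∣ ≡ k) × (subsetSum A % n ≡ r % n)
  where open import Data.Product using (_×_)

affine : ∀ {n} .{{_ : NonZero n}} → ℤ → ℤ → Fin n → Fin n
affine {n} z y a = fromℕ< (n%ℕd<d ((z *ℤ (+ toℕ a)) +ℤ y) n)

image : ∀ {n} → (Fin n → Fin n) → Subset n → Subset n
image f A = tabulate (λ j → does (any? (λ a → (a ∈? A) ×-dec (f a ≟ j))))

-- An affine map a ↦ z a + y with z a unit modulo n permutes ℤ/n, preserves the size of a
-- subset and sends a k-subset with element sum s to one with element sum z s + y k.  So it
-- suffices to find a unit z and some y with z r + y k ≡ 1 (mod n); the inverse bijection is
-- the affine map with coefficients w = z⁻¹ and -w y.  Let d = gcd(n, k), so d ≡ t k (mod n)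
-- for some t.  As gcd(d, r) = 1 there is an m with r + d m coprime to n; for z the inverse
-- of r + d m and y = z m t we get z r + y k ≡ z (r + d m) ≡ 1.
module Submission where

open import Defs
open import Data.Nat using (ℕ; _≤_; _<_; NonZero)
open import Data.Nat.GCD using (gcd)
open import Data.Integer using (ℤ)
open import Data.Fin.Subset using (Subset)
open import Data.Product using (Σ; ∃; _×_; _,_)
open import Relation.Binary.PropositionalEquality using (_≡_)

open import Algebra.Bundles using (CommutativeMonoid)
open import Data.Bool using (true; false; if_then_else_)
open import Data.Fin as Fin using (Fin; toℕ)
import Data.Fin.Properties as Fin
open import Data.Fin.Properties using (any?)
open import Data.Fin.Permutation
  using (Permutation′; permutation; flip; _⟨$⟩ʳ_; _⟨$⟩ˡ_; inverseˡ; inverseʳ)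
open import Data.Fin.Subset using (∣_∣; _∈_)
open import Data.Fin.Subset.Properties using (_∈?_)
open import Data.Integer as ℤ using (+_; _+_; _-_; _*_; -_; 0ℤ; 1ℤ)
import Data.Integer.Properties as ℤ
open import Data.Integer.DivMod using (_%ℕ_; _/ℕ_; a≡a%ℕn+[a/ℕn]*n)
open import Data.Integer.Divisibility.Signed
  using (_∣_; divides; ∣⇒∣ᵤ; ∣m∣n⇒∣m+n; ∣m⇒∣-m; ∣n⇒∣m*n)
open import Data.Integer.Tactic.RingSolver using (solve-∀)
import Data.List as List using (tabulate)
import Data.List.Properties as List using (map-tabulate)
open import Data.Nat as ℕ using (_%_)
import Data.Nat.ListAction as ListAction
import Data.Nat.Properties as ℕ
open import Data.Nat.Coprimality using (Coprime; coprime-divisor; gcd≡1⇒coprime; coprime-Bézout)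
open import Data.Nat.Divisibility as ℕ using (∣-refl; ∣-trans; ∣m+n∣m⇒∣n; n∣m*n)
open import Data.Nat.DivMod using (m≡m%n+[m/n]*n; m%n<n; m<n⇒m%n≡m)
open import Data.Nat.GCD using (gcd[m,n]∣m; gcd[m,n]∣n; gcd[m,n]≡0⇒m≡0; gcd-GCD; module Bézout)
open import Data.Nat.Induction using (<-wellFounded)
open import Data.Vec using (Vec; lookup; []; _∷_)
import Data.Vec.Properties as Vec
open import Function using (_∘_; id; case_of_)
open import Induction.WellFounded using (Acc; acc)
open import Relation.Binary.Bundles using (Setoid)
import Relation.Binary.Reasoning.Setoid as SetoidReasoning
open import Relation.Binary.Structures using (IsEquivalence)
open import Relation.Binary.PropositionalEquality
  using (_≢_; _≗_; refl; sym; trans; cong; cong₂; subst; subst₂; module ≡-Reasoning)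
open import Relation.Nullary using (Dec; does; yes; no)
open import Relation.Nullary.Decidable using (dec-true; dec-false; _×-dec_)

infix 4 _≡_mod_

record _≡_mod_ (x y : ℤ) (n : ℕ) : Set where
  constructor divides-difference
  field n∣x-y : + n ∣ x - y

module _ {n : ℕ} where

  ≡-mod-reflexive : ∀ {x y} → x ≡ y → x ≡ y mod n
  ≡-mod-reflexive {x} refl = divides-difference (divides 0ℤ (ℤ.+-inverseʳ x))

  ≡-mod-refl : ∀ {x} → x ≡ x mod n
  ≡-mod-refl = ≡-mod-reflexive refl

  ≡-mod-sym : ∀ {x y} → x ≡ y mod n → y ≡ x mod n
  ≡-mod-sym {x} {y} (divides-difference n∣x-y) =
    divides-difference (subst (+ n ∣_) (negate x y) (∣m⇒∣-m n∣x-y))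
    where
    negate : ∀ x y → - (x - y) ≡ y - x
    negate = solve-∀

  ≡-mod-trans : ∀ {x y w} → x ≡ y mod n → y ≡ w mod n → x ≡ w mod n
  ≡-mod-trans {x} {y} {w} (divides-difference n∣x-y) (divides-difference n∣y-w) =
    divides-difference (subst (+ n ∣_) (ℤ.+-minus-telescope x y w) (∣m∣n⇒∣m+n n∣x-y n∣y-w))

  ≡-mod-isEquivalence : IsEquivalence (_≡_mod n)
  ≡-mod-isEquivalence = record { refl = ≡-mod-refl ; sym = ≡-mod-sym ; trans = ≡-mod-trans }

  ≡-mod-setoid : Setoid _ _
  ≡-mod-setoid = record { isEquivalence = ≡-mod-isEquivalence }

  ≡+*⇒≡-mod : ∀ {x y} q → x ≡ y + q * + n → x ≡ y mod n
  ≡+*⇒≡-mod {y = y} q refl = divides-difference (divides q (cancel y q (+ n)))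
    where
    cancel : ∀ y q m → (y + q * m) - y ≡ q * m
    cancel = solve-∀

  +-cong-≡-mod : ∀ {x x′ y y′} → x ≡ x′ mod n → y ≡ y′ mod n → x + y ≡ x′ + y′ mod n
  +-cong-≡-mod {x} {x′} {y} {y′} (divides-difference n∣x-x′) (divides-difference n∣y-y′) =
    divides-difference (subst (+ n ∣_) (regroup x x′ y y′) (∣m∣n⇒∣m+n n∣x-x′ n∣y-y′))
    where
    regroup : ∀ x x′ y y′ → (x - x′) + (y - y′) ≡ (x + y) - (x′ + y′)
    regroup = solve-∀

  +-congˡ-≡-mod : ∀ c {y y′} → y ≡ y′ mod n → c + y ≡ c + y′ mod n
  +-congˡ-≡-mod c = +-cong-≡-mod (≡-mod-refl {c})

  +-congʳ-≡-mod : ∀ c {x x′} → x ≡ x′ mod n → x + c ≡ x′ + c mod n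
  +-congʳ-≡-mod c x≡x′ = +-cong-≡-mod x≡x′ (≡-mod-refl {c})

  *-congˡ-≡-mod : ∀ c {x x′} → x ≡ x′ mod n → c * x ≡ c * x′ mod n
  *-congˡ-≡-mod c {x} {x′} (divides-difference n∣x-x′) =
    divides-difference (subst (+ n ∣_) (distrib c x x′) (∣n⇒∣m*n c n∣x-x′))
    where
    distrib : ∀ c x x′ → c * (x - x′) ≡ c * x - c * x′
    distrib = solve-∀

  *-congʳ-≡-mod : ∀ c {x x′} → x ≡ x′ mod n → x * c ≡ x′ * c mod n
  *-congʳ-≡-mod c {x} {x′} x≡x′ =
    subst₂ (_≡_mod n) (ℤ.*-comm c x) (ℤ.*-comm c x′) (*-congˡ-≡-mod c x≡x′)

  invert-≡-mod : ∀ {a b c} z y w → w * z ≡ 1ℤ mod n → z * a + y * b ≡ c mod n →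
    w * c + - (w * y) * b ≡ a mod n
  invert-≡-mod {a} {b} {c} z y w wz≡1 za+yb≡c = begin
    w * c + - (w * y) * b               ≈⟨ +-congʳ-≡-mod (- (w * y) * b)
                                             (*-congˡ-≡-mod w (≡-mod-sym za+yb≡c)) ⟩
    w * (z * a + y * b) + - (w * y) * b ≡⟨ cancel w z a y b ⟩
    w * z * a                           ≈⟨ *-congʳ-≡-mod a wz≡1 ⟩
    1ℤ * a                              ≡⟨ ℤ.*-identityˡ a ⟩
    a                                   ∎
    where
    open SetoidReasoning ≡-mod-setoid
    cancel : ∀ w z a y b → w * (z * a + y * b) + - (w * y) * b ≡ w * z * a
    cancel = solve-∀

module _ {n : ℕ} .{{_ : NonZero n}} where

  %ℕ-≡-mod : ∀ x → + (x %ℕ n) ≡ x mod n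
  %ℕ-≡-mod x = ≡-mod-sym (≡+*⇒≡-mod (x /ℕ n) (a≡a%ℕn+[a/ℕn]*n x n))

  %-≡-mod : ∀ a → + (a % n) ≡ + a mod n
  %-≡-mod a = ≡-mod-sym (≡+*⇒≡-mod (+ (a ℕ./ n)) (begin
    + a                            ≡⟨ cong +_ (m≡m%n+[m/n]*n a n) ⟩
    + (a % n ℕ.+ a ℕ./ n ℕ.* n)    ≡⟨ ℤ.pos-+ (a % n) _ ⟩
    + (a % n) + + (a ℕ./ n ℕ.* n)  ≡⟨ cong (_+_ (+ (a % n))) (ℤ.pos-* (a ℕ./ n) n) ⟩
    + (a % n) + + (a ℕ./ n) * + n  ∎))
    where open ≡-Reasoning

  residue-unique : ∀ {a b} → a < n → b < n → + a ≡ + b mod n → a ≡ b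
  residue-unique {a} {b} a<n b<n (divides-difference n∣a-b) =
    ℤ.+-injective (ℤ.i-j≡0⇒i≡j (+ a) (+ b) (ℤ.∣i∣≡0⇒i≡0 ∣a-b∣≡0))
    where
    ∣a-b∣<n : ℤ.∣ + a - + b ∣ < n
    ∣a-b∣<n = subst (_< n) (cong ℤ.∣_∣ (sym (ℤ.m-n≡m⊖n a b)))
                (ℕ.≤-<-trans (ℤ.∣m⊝n∣≤m⊔n a b) (ℕ.⊔-pres-<m a<n b<n))
    ∣a-b∣≡0 : ℤ.∣ + a - + b ∣ ≡ 0
    ∣a-b∣≡0 = trans (sym (m<n⇒m%n≡m ∣a-b∣<n)) (ℕ.n∣m⇒m%n≡0 _ n (∣⇒∣ᵤ n∣a-b))

  %≡%⇒≡-mod : ∀ {a b} → a % n ≡ b % n → + a ≡ + b mod n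
  %≡%⇒≡-mod {a} {b} a%n≡b%n = ≡-mod-trans (≡-mod-sym (%-≡-mod a))
    (≡-mod-trans (≡-mod-reflexive (cong +_ a%n≡b%n)) (%-≡-mod b))

  ≡-mod⇒%≡% : ∀ {a b} → + a ≡ + b mod n → a % n ≡ b % n
  ≡-mod⇒%≡% {a} {b} a≡b = residue-unique (m%n<n a n) (m%n<n b n)
    (≡-mod-trans (%-≡-mod a) (≡-mod-trans a≡b (≡-mod-sym (%-≡-mod b))))

  toℕ-injective-mod : ∀ {i j : Fin n} → + toℕ i ≡ + toℕ j mod n → i ≡ j
  toℕ-injective-mod i≡j = Fin.toℕ-injective (residue-unique (Fin.toℕ<n _) (Fin.toℕ<n _) i≡j)

-- m is the largest divisor of n coprime to r, obtained by repeatedly dividing by gcd(n, r).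
coprime-part : ∀ r n → n ≢ 0 →
  ∃ λ m → Coprime m r × (∀ {g} → g ℕ.∣ n → Coprime g r → g ℕ.∣ m)
coprime-part r n n≢0 = go n n≢0 (<-wellFounded n)
  where
  go : ∀ n → n ≢ 0 → Acc _<_ n →
    ∃ λ m → Coprime m r × (∀ {g} → g ℕ.∣ n → Coprime g r → g ℕ.∣ m)
  go n n≢0 (acc rec) with gcd n r ℕ.≟ 1 | gcd[m,n]∣m n r
  ... | yes gcd≡1 | _ = n , gcd≡1⇒coprime gcd≡1 , λ g∣n _ → g∣n
  ... | no gcd≢1 | ℕ.divides n′ n≡n′*c with go n′ n′≢0 (rec n′<n)
    where
    c : ℕ
    c = gcd n r
    n′≢0 : n′ ≢ 0
    n′≢0 n′≡0 = n≢0 (trans n≡n′*c (cong (ℕ._* c) n′≡0))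
    1<c : 1 < c
    1<c = ℕ.≤∧≢⇒< (ℕ.n≢0⇒n>0 (n≢0 ∘ gcd[m,n]≡0⇒m≡0)) (gcd≢1 ∘ sym)
    n′<n : n′ < n
    n′<n = subst (n′ <_) (sym n≡n′*c) (ℕ.m<m*n n′ c {{ℕ.≢-nonZero n′≢0}} 1<c)
  ... | m , m⊥r , maximal = m , m⊥r , λ g∣n g⊥r → maximal (g∣n′ g∣n g⊥r) g⊥r
    where
    g∣n′ : ∀ {g} → g ℕ.∣ n → Coprime g r → g ℕ.∣ n′
    g∣n′ {g} g∣n g⊥r =
      coprime-divisor (λ (h∣g , h∣c) → g⊥r (h∣g , ∣-trans h∣c (gcd[m,n]∣n n r)))
        (subst (g ℕ.∣_) (trans n≡n′*c (ℕ.*-comm n′ (gcd n r))) g∣n)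

-- With m the part of n coprime to r: a common divisor g of r + d m and n is coprime to r
-- (a common factor with r would divide d m, hence d), so g divides m, hence r, so g = 1.
coprime-shift : ∀ {d r} n → n ≢ 0 → Coprime d r → ∃ λ m → Coprime (r ℕ.+ d ℕ.* m) n
coprime-shift {d} {r} n n≢0 d⊥r with coprime-part r n n≢0
... | m , m⊥r , maximal = m , λ (g∣r+dm , g∣n) → g⊥r g∣r+dm (∣-refl , g∣r g∣r+dm g∣n)
  where
  g⊥r : ∀ {g} → g ℕ.∣ r ℕ.+ d ℕ.* m → Coprime g r
  g⊥r g∣r+dm {h} (h∣g , h∣r) = d⊥r (h∣d , h∣r)
    where
    h∣d : h ℕ.∣ d
    h∣d = coprime-divisor (λ (e∣h , e∣m) → m⊥r (e∣m , ∣-trans e∣h h∣r))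
            (subst (h ℕ.∣_) (ℕ.*-comm d m) (∣m+n∣m⇒∣n (∣-trans h∣g g∣r+dm) h∣r))
  g∣r : ∀ {g} → g ℕ.∣ r ℕ.+ d ℕ.* m → g ℕ.∣ n → g ℕ.∣ r
  g∣r {g} g∣r+dm g∣n = ∣m+n∣m⇒∣n (subst (g ℕ.∣_) (ℕ.+-comm r (d ℕ.* m)) g∣r+dm)
                         (∣-trans (maximal g∣n (g⊥r g∣r+dm)) (n∣m*n d))

pos-+-* : ∀ d x a → + (d ℕ.+ x ℕ.* a) ≡ + d + + x * + a
pos-+-* d x a = trans (ℤ.pos-+ d (x ℕ.* a)) (cong (_+_ (+ d)) (ℤ.pos-* x a))

Bézout⇒≡-mod : ∀ {d a b} → Bézout.Identity d a b → ∃ λ u → u * + a ≡ + d mod b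
Bézout⇒≡-mod {d} {a} {b} (Bézout.+- x y d+yb≡xa) = + x , ≡+*⇒≡-mod (+ y) (begin
  + x * + a          ≡⟨ ℤ.pos-* x a ⟨
  + (x ℕ.* a)        ≡⟨ cong +_ d+yb≡xa ⟨
  + (d ℕ.+ y ℕ.* b)  ≡⟨ pos-+-* d y b ⟩
  + d + + y * + b    ∎)
  where open ≡-Reasoning
Bézout⇒≡-mod {d} {a} {b} (Bézout.-+ x y d+xa≡yb) = - + x , ≡+*⇒≡-mod (- + y) (begin
  - + x * + a                ≡⟨ cancel (+ d) (+ x) (+ a) ⟩
  + d + - (+ d + + x * + a)  ≡⟨ cong (λ t → + d + - t) (trans (sym (pos-+-* d x a)) (cong +_ d+xa≡yb)) ⟩
  + d + - (+ (y ℕ.* b))      ≡⟨ cong (λ t → + d + - t) (ℤ.pos-* y b) ⟩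
  + d + - (+ y * + b)        ≡⟨ cong (_+_ (+ d)) (ℤ.neg-distribˡ-* (+ y) (+ b)) ⟩
  + d + - + y * + b          ∎)
  where
  open ≡-Reasoning
  cancel : ∀ d x a → - x * a ≡ d + - (d + x * a)
  cancel = solve-∀

affine-coefficients : ∀ n k r → n ≢ 0 → gcd (gcd n k) r ≡ 1 →
  ∃ λ z → ∃ λ y → ∃ λ w → w * z ≡ 1ℤ mod n × z * + r + y * + k ≡ 1ℤ mod n
affine-coefficients n k r n≢0 gcd≡1
  with coprime-shift {gcd n k} {r} n n≢0 (gcd≡1⇒coprime gcd≡1)
... | m , r′⊥n
  with Bézout⇒≡-mod (coprime-Bézout r′⊥n)
     | Bézout⇒≡-mod (Bézout.Identity.sym (Bézout.identity (gcd-GCD n k)))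
... | u , ur′≡1 | t , tk≡d = u , u * + m * t , + r′ , r′u≡1 , ur+umtk≡1
  where
  open SetoidReasoning (≡-mod-setoid {n})
  d r′ : ℕ
  d = gcd n k
  r′ = r ℕ.+ d ℕ.* m
  r′u≡1 : + r′ * u ≡ 1ℤ mod n
  r′u≡1 = ≡-mod-trans (≡-mod-reflexive (ℤ.*-comm (+ r′) u)) ur′≡1
  regroup : ∀ u r m t k → u * r + u * m * t * k ≡ u * r + u * m * (t * k)
  regroup = solve-∀
  factor : ∀ u r m d → u * r + u * m * d ≡ u * (r + d * m)
  factor = solve-∀
  ur+umtk≡1 : u * + r + u * + m * t * + k ≡ 1ℤ mod n
  ur+umtk≡1 = begin
    u * + r + u * + m * t * + k    ≡⟨ regroup u (+ r) (+ m) t (+ k) ⟩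
    u * + r + u * + m * (t * + k)  ≈⟨ +-congˡ-≡-mod (u * + r) (*-congˡ-≡-mod (u * + m) tk≡d) ⟩
    u * + r + u * + m * + d        ≡⟨ factor u (+ r) (+ m) (+ d) ⟩
    u * (+ r + + d * + m)          ≡⟨ cong (u *_) (pos-+-* r d m) ⟨
    u * + r′                       ≈⟨ ur′≡1 ⟩
    1ℤ                             ∎

module _ {n : ℕ} .{{_ : NonZero n}} where
  open SetoidReasoning (≡-mod-setoid {n})

  affine-≡-mod : ∀ z y (a : Fin n) → + toℕ (affine z y a) ≡ z * + toℕ a + y mod n
  affine-≡-mod z y a = subst (λ m → + m ≡ z * + toℕ a + y mod n) (sym (Fin.toℕ-fromℕ< _))
                         (%ℕ-≡-mod (z * + toℕ a + y))

  affine-leftInverse : ∀ z y w → w * z ≡ 1ℤ mod n → affine w (- (w * y)) ∘ affine z y ≗ id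
  affine-leftInverse z y w wz≡1 a = toℕ-injective-mod (begin
    + toℕ (affine w (- (w * y)) (affine z y a))  ≈⟨ affine-≡-mod w (- (w * y)) (affine z y a) ⟩
    w * + toℕ (affine z y a) + - (w * y)         ≈⟨ +-congʳ-≡-mod (- (w * y))
                                                      (*-congˡ-≡-mod w (affine-≡-mod z y a)) ⟩
    w * (z * + toℕ a + y) + - (w * y)            ≡⟨ cancel w z (+ toℕ a) y ⟩
    w * z * + toℕ a                              ≈⟨ *-congʳ-≡-mod (+ toℕ a) wz≡1 ⟩
    1ℤ * + toℕ a                                 ≡⟨ ℤ.*-identityˡ (+ toℕ a) ⟩
    + toℕ a                                      ∎)
    where
    cancel : ∀ w z a y → w * (z * a + y) + - (w * y) ≡ w * z * a
    cancel = solve-∀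

  affine-rightInverse : ∀ z y w → w * z ≡ 1ℤ mod n → affine z y ∘ affine w (- (w * y)) ≗ id
  affine-rightInverse z y w wz≡1 j = toℕ-injective-mod (begin
    + toℕ (affine z y (affine w (- (w * y)) j))  ≈⟨ affine-≡-mod z y (affine w (- (w * y)) j) ⟩
    z * + toℕ (affine w (- (w * y)) j) + y       ≈⟨ +-congʳ-≡-mod y
                                                      (*-congˡ-≡-mod z (affine-≡-mod w (- (w * y)) j)) ⟩
    z * (w * + toℕ j + - (w * y)) + y            ≡⟨ regroup w z (+ toℕ j) y ⟩
    w * z * (+ toℕ j - y) + y                    ≈⟨ +-congʳ-≡-mod y (*-congʳ-≡-mod (+ toℕ j - y) wz≡1) ⟩
    1ℤ * (+ toℕ j - y) + y                       ≡⟨ cancel (+ toℕ j) y ⟩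
    + toℕ j                                      ∎)
    where
    regroup : ∀ w z j y → z * (w * j + - (w * y)) + y ≡ w * z * (j - y) + y
    regroup = solve-∀
    cancel : ∀ j y → 1ℤ * (j - y) + y ≡ j
    cancel = solve-∀

  affine-permutation : ∀ z y w → w * z ≡ 1ℤ mod n → Permutation′ n
  affine-permutation z y w wz≡1 = permutation (affine z y) (affine w (- (w * y)))
    (affine-rightInverse z y w wz≡1) (affine-leftInverse z y w wz≡1)

lookup-extensionality : ∀ {a} {A : Set a} {n} {u v : Vec A n} → lookup u ≗ lookup v → u ≡ v
lookup-extensionality {u = u} {v} u≗v =
  trans (sym (Vec.tabulate∘lookup u)) (trans (Vec.tabulate-cong u≗v) (Vec.tabulate∘lookup v))

module _ {n : ℕ} where

  lookup-image : ∀ (π : Permutation′ n) A j → lookup (image (π ⟨$⟩ʳ_) A) j ≡ lookup A (π ⟨$⟩ˡ j)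
  lookup-image π A j = trans (Vec.lookup∘tabulate _ j) (decide _ refl)
    where
    hit? : Dec (∃ λ a → a ∈ A × π ⟨$⟩ʳ a ≡ j)
    hit? = any? (λ a → (a ∈? A) ×-dec (π ⟨$⟩ʳ a Fin.≟ j))
    decide : ∀ b → lookup A (π ⟨$⟩ˡ j) ≡ b → does hit? ≡ b
    decide true  A[π⁻¹j] = dec-true hit? (π ⟨$⟩ˡ j , Vec.lookup⇒[]= _ A A[π⁻¹j] , inverseʳ π)
    decide false A[π⁻¹j] = dec-false hit? λ (a , a∈A , πa≡j) →
      case trans (sym A[π⁻¹j]) (subst (λ i → lookup A i ≡ true)
             (trans (sym (inverseˡ π)) (cong (π ⟨$⟩ˡ_) πa≡j)) (Vec.[]=⇒lookup a∈A)) of λ ()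

  image-injective : ∀ (π : Permutation′ n) {A B} → image (π ⟨$⟩ʳ_) A ≡ image (π ⟨$⟩ʳ_) B → A ≡ B
  image-injective π {A} {B} πA≡πB = lookup-extensionality λ a → begin
    lookup A a                             ≡⟨ cong (lookup A) (inverseˡ π) ⟨
    lookup A (π ⟨$⟩ˡ (π ⟨$⟩ʳ a))           ≡⟨ lookup-image π A (π ⟨$⟩ʳ a) ⟨
    lookup (image (π ⟨$⟩ʳ_) A) (π ⟨$⟩ʳ a)  ≡⟨ cong (λ C → lookup C (π ⟨$⟩ʳ a)) πA≡πB ⟩
    lookup (image (π ⟨$⟩ʳ_) B) (π ⟨$⟩ʳ a)  ≡⟨ lookup-image π B (π ⟨$⟩ʳ a) ⟩
    lookup B (π ⟨$⟩ˡ (π ⟨$⟩ʳ a))           ≡⟨ cong (lookup B) (inverseˡ π) ⟩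
    lookup B a                             ∎
    where open ≡-Reasoning

  image-image-inverse : ∀ (π : Permutation′ n) B → image (π ⟨$⟩ʳ_) (image (π ⟨$⟩ˡ_) B) ≡ B
  image-image-inverse π B = lookup-extensionality λ j → begin
    lookup (image (π ⟨$⟩ʳ_) (image (π ⟨$⟩ˡ_) B)) j  ≡⟨ lookup-image π (image (π ⟨$⟩ˡ_) B) j ⟩
    lookup (image (π ⟨$⟩ˡ_) B) (π ⟨$⟩ˡ j)            ≡⟨ lookup-image (flip π) B (π ⟨$⟩ˡ j) ⟩
    lookup B (π ⟨$⟩ʳ (π ⟨$⟩ˡ j))                     ≡⟨ cong (lookup B) (inverseʳ π) ⟩
    lookup B j                                        ∎
    where open ≡-Reasoning

module SubsetSum {c ℓ} (M : CommutativeMonoid c ℓ) where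
  open CommutativeMonoid M
  open import Algebra.Properties.CommutativeMonoid.Sum M using (sum-cong-≗; sum-permute)
  open import Algebra.Properties.CommutativeMonoid.Sum M public using (sum)
  open SetoidReasoning setoid

  sumOver : ∀ {n} → Subset n → (Fin n → Carrier) → Carrier
  sumOver A f = sum (λ a → if lookup A a then f a else ε)

  sumOver-image : ∀ {n} (π : Permutation′ n) A f →
    sumOver (image (π ⟨$⟩ʳ_) A) f ≈ sumOver A (f ∘ (π ⟨$⟩ʳ_))
  sumOver-image π A f = begin
    sumOver (image (π ⟨$⟩ʳ_) A) f
      ≡⟨ sum-cong-≗ (λ j → cong (λ b → if b then f j else ε) (lookup-image π A j)) ⟩
    sum (λ j → if lookup A (π ⟨$⟩ˡ j) then f j else ε)
      ≈⟨ sum-permute _ π ⟩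
    sum (λ a → if lookup A (π ⟨$⟩ˡ (π ⟨$⟩ʳ a)) then f (π ⟨$⟩ʳ a) else ε)
      ≡⟨ sum-cong-≗ (λ a → cong (λ i → if lookup A i then f (π ⟨$⟩ʳ a) else ε) (inverseˡ π)) ⟩
    sumOver A (f ∘ (π ⟨$⟩ʳ_))
      ∎

module ℕΣ = SubsetSum ℕ.+-0-commutativeMonoid
module ℤΣ = SubsetSum ℤ.+-0-commutativeMonoid

sum-tabulate : ∀ {n} (f : Fin n → ℕ) → ListAction.sum (List.tabulate f) ≡ ℕΣ.sum f
sum-tabulate {ℕ.zero}  f = refl
sum-tabulate {ℕ.suc n} f = cong (f Fin.zero ℕ.+_) (sum-tabulate (f ∘ Fin.suc))

subsetSum≡sumOver : ∀ {n} (A : Subset n) → subsetSum A ≡ ℕΣ.sumOver A toℕ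
subsetSum≡sumOver {n} A =
  trans (cong ListAction.sum (List.map-tabulate {n = n} id element)) (sum-tabulate element)
  where
  element : Fin n → ℕ
  element a = if lookup A a then toℕ a else 0

∣∣≡sumOver : ∀ {n} (A : Subset n) → ∣ A ∣ ≡ ℕΣ.sumOver A (λ _ → 1)
∣∣≡sumOver []          = refl
∣∣≡sumOver (true ∷ A)  = cong ℕ.suc (∣∣≡sumOver A)
∣∣≡sumOver (false ∷ A) = ∣∣≡sumOver A

∣image∣≡∣∣ : ∀ {n} (π : Permutation′ n) A → ∣ image (π ⟨$⟩ʳ_) A ∣ ≡ ∣ A ∣
∣image∣≡∣∣ π A = begin
  ∣ image (π ⟨$⟩ʳ_) A ∣                      ≡⟨ ∣∣≡sumOver (image (π ⟨$⟩ʳ_) A) ⟩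
  ℕΣ.sumOver (image (π ⟨$⟩ʳ_) A) (λ _ → 1)  ≡⟨ ℕΣ.sumOver-image π A (λ _ → 1) ⟩
  ℕΣ.sumOver A (λ _ → 1)                    ≡⟨ ∣∣≡sumOver A ⟨
  ∣ A ∣                                     ∎
  where open ≡-Reasoning

pos-sumOver : ∀ {n} (A : Subset n) f → + ℕΣ.sumOver A f ≡ ℤΣ.sumOver A (+_ ∘ f)
pos-sumOver []          f = refl
pos-sumOver (true ∷ A)  f =
  trans (ℤ.pos-+ (f Fin.zero) _) (cong (_+_ (+ f Fin.zero)) (pos-sumOver A (f ∘ Fin.suc)))
pos-sumOver (false ∷ A) f = trans (pos-sumOver A (f ∘ Fin.suc)) (sym (ℤ.+-identityˡ _))

sumOver-affine : ∀ {n} (A : Subset n) (t : Fin n → ℤ) z y →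
  ℤΣ.sumOver A (λ a → z * t a + y) ≡ z * ℤΣ.sumOver A t + y * ℤΣ.sumOver A (λ _ → 1ℤ)
sumOver-affine []          t z y = annihilate z y
  where
  annihilate : ∀ z y → 0ℤ ≡ z * 0ℤ + y * 0ℤ
  annihilate = solve-∀
sumOver-affine (true ∷ A)  t z y = trans
  (cong (_+_ (z * t Fin.zero + y)) (sumOver-affine A (t ∘ Fin.suc) z y)) (regroup z y (t Fin.zero) _ _)
  where
  regroup : ∀ z y t₀ T C → z * t₀ + y + (z * T + y * C) ≡ z * (t₀ + T) + y * (1ℤ + C)
  regroup = solve-∀
sumOver-affine (false ∷ A) t z y = trans
  (cong (_+_ 0ℤ) (sumOver-affine A (t ∘ Fin.suc) z y)) (regroup z y _ _)
  where
  regroup : ∀ z y T C → 0ℤ + (z * T + y * C) ≡ z * (0ℤ + T) + y * (0ℤ + C)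
  regroup = solve-∀

sumOver-cong-≡-mod : ∀ {n m} (A : Subset m) {f g : Fin m → ℤ} →
  (∀ a → f a ≡ g a mod n) → ℤΣ.sumOver A f ≡ ℤΣ.sumOver A g mod n
sumOver-cong-≡-mod []          f≡g = ≡-mod-refl
sumOver-cong-≡-mod (true ∷ A)  f≡g =
  +-cong-≡-mod (f≡g Fin.zero) (sumOver-cong-≡-mod A (f≡g ∘ Fin.suc))
sumOver-cong-≡-mod (false ∷ A) f≡g = +-congˡ-≡-mod 0ℤ (sumOver-cong-≡-mod A (f≡g ∘ Fin.suc))

module _ {n : ℕ} .{{_ : NonZero n}} where
  open SetoidReasoning (≡-mod-setoid {n})

  subsetSum-image-affine : ∀ z y w → w * z ≡ 1ℤ mod n → ∀ A →
    + subsetSum (image (affine z y) A) ≡ z * + subsetSum A + y * + ∣ A ∣ mod n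
  subsetSum-image-affine z y w wz≡1 A = begin
    + subsetSum (image f A)                   ≡⟨ cong +_ (subsetSum≡sumOver (image f A)) ⟩
    + ℕΣ.sumOver (image f A) toℕ              ≡⟨ cong +_ (ℕΣ.sumOver-image π A toℕ) ⟩
    + ℕΣ.sumOver A (toℕ ∘ f)                  ≡⟨ pos-sumOver A (toℕ ∘ f) ⟩
    ℤΣ.sumOver A (λ a → + toℕ (f a))          ≈⟨ sumOver-cong-≡-mod A (affine-≡-mod z y) ⟩
    ℤΣ.sumOver A (λ a → z * + toℕ a + y)      ≡⟨ sumOver-affine A (λ a → + toℕ a) z y ⟩
    z * ℤΣ.sumOver A (λ a → + toℕ a) + y * ℤΣ.sumOver A (λ _ → 1ℤ)
      ≡⟨ cong₂ (λ s c → z * s + y * c) (pos-sumOver A toℕ) (pos-sumOver A (λ _ → 1)) ⟨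
    z * + ℕΣ.sumOver A toℕ + y * + ℕΣ.sumOver A (λ _ → 1)
      ≡⟨ cong₂ (λ s c → z * + s + y * + c) (subsetSum≡sumOver A) (∣∣≡sumOver A) ⟨
    z * + subsetSum A + y * + ∣ A ∣           ∎
    where
    f : Fin n → Fin n
    f = affine z y
    π : Permutation′ n
    π = affine-permutation z y w wz≡1

  image-affine-S̄ : ∀ {r s k} z y w → w * z ≡ 1ℤ mod n → z * + r + y * + k ≡ + s mod n →
    ∀ A → S̄ r n k A → S̄ s n k (image (affine z y) A)
  image-affine-S̄ {r} {s} {k} z y w wz≡1 zr+yk≡s A (∣A∣≡k , ΣA≡r) =
    trans (∣image∣≡∣∣ (affine-permutation z y w wz≡1) A) ∣A∣≡k ,
    ≡-mod⇒%≡% (begin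
      + subsetSum (image (affine z y) A)  ≈⟨ subsetSum-image-affine z y w wz≡1 A ⟩
      z * + subsetSum A + y * + ∣ A ∣     ≈⟨ +-cong-≡-mod (*-congˡ-≡-mod z (%≡%⇒≡-mod ΣA≡r))
                                               (≡-mod-reflexive (cong (λ c → y * + c) ∣A∣≡k)) ⟩
      z * + r + y * + k                   ≈⟨ zr+yk≡s ⟩
      + s                                 ∎)

proposition4p5 : (n k r : ℕ) → .{{_ : NonZero n}} → 2 ≤ n → k ≤ n → r < n →
    gcd (gcd n k) r ≡ 1 →
    Σ ℤ λ y → Σ ℤ λ z →
      ((A : Subset n) → S̄ r n k A → S̄ 1 n k (image (affine z y) A))
      × ((A B : Subset n) → S̄ r n k A → S̄ r n k B →
           image (affine z y) A ≡ image (affine z y) B → A ≡ B)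
      × ((B : Subset n) → S̄ 1 n k B →
           Σ (Subset n) λ A → S̄ r n k A × (image (affine z y) A ≡ B))
proposition4p5 n k r _ _ _ gcd≡1 =
  let z , y , w , wz≡1 , zr+yk≡1 = affine-coefficients n k r (ℕ.≢-nonZero⁻¹ n) gcd≡1
      π : Permutation′ n
      π = affine-permutation z y w wz≡1
      zw≡1 : z * w ≡ 1ℤ mod n
      zw≡1 = ≡-mod-trans (≡-mod-reflexive (ℤ.*-comm z w)) wz≡1
  in y , z , image-affine-S̄ z y w wz≡1 zr+yk≡1 ,
     (λ A B _ _ → image-injective π {A} {B}) ,
     λ B B∈S̄₁ → image (affine w (- (w * y))) B ,
       image-affine-S̄ w (- (w * y)) z zw≡1 (invert-≡-mod z y w wz≡1 zr+yk≡1) B B∈S̄₁ ,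
       image-image-inverse π B
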